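{- For every integer $n\ge0$, $\mathbf{s}_{(n)}=\mathbf{r}_{(n)}$ and $\mathbf{s}_{(1^n)}=\mathbf{r}_{(1^n)}$, where $(1^n)$ is the composition consisting of $n$ ones.
   Context: $\mathbf{NSym}$ is the free associative $\mathbb{Q}$-algebra on $\mathbf{h}_1,\mathbf{h}_2,\ldots$; for a composition $\alpha=(\alpha_1,\ldots,\alpha_k)$, $\mathbf{h}_\alpha=\mathbf{h}_{\alpha_1}\cdots\mathbf{h}_{\alpha_k}$ (empty product $1$). For compositions of equal size, $\alpha\succcurlyeq\beta$ means the parts of $\alpha$ are obtained by adding together consecutive parts of $\beta$. Ribbon functions: $\mathbf{r}_\beta=\sum_{\alpha\succcurlyeq\beta}(-1)^{l(\beta)-l(\alpha)}\mathbf{h}_\alpha$, $l$ denoting number of parts. The diagram of a composition $\alpha$ is the set of boxes $(i,j)$, $1\le i\le l(\alpha)$, $1\le j\le\alpha_i$ (rows top to bottom). A standard reverse composition tableau (SRCT) of shape $\alpha\vDash N$ is a filling $\tau$ of the diagram of $\alpha$ using each of $1,\ldots,N$ once such that rows decrease left to right, the first column increases top to bottom, and whenever $i<i'$, $(i',k+1)\in\alpha$, $(i,k)\in\alpha$ and $\tau(i,k)\ge\tau(i',k+1)$, then $(i,k+1)\in\alpha$ and $\tau(i,k+1)>\tau(i',k+1)$. Its descent set is the set of $m$ such that $m+1$ lies in a column weakly right of that of $m$; its descent composition is the composition of $N$ whose partial sums are the elements of the descent set. $d_{\alpha,\beta}$ is the number of SRCTs of shape $\alpha$ with descent composition $\beta$.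 The noncommutative Schur functions $\mathbf{s}_\alpha$ form the basis of $\mathbf{NSym}$ determined by $\mathbf{r}_\beta=\sum_{\alpha\vDash|\beta|}d_{\alpha,\beta}\mathbf{s}_\alpha$ for all $\beta$. -}

module Defs where

open import Data.Bool using (Bool; true; false; _∧_; _∨_; not; if_then_else_)
open import Data.Nat as ℕ using (ℕ; zero; suc; _<ᵇ_; _≤ᵇ_; _∸_)
open import Data.List using (List; []; _∷_; _++_; map; concatMap; filter; length; take; drop; replicate; foldr; head)
open import Data.Nat.ListAction using (sum)
open import Data.List.Properties using (≡-dec)
open import Data.Maybe using (Maybe; just; nothing)
open import Data.Integer using (+_)
open import Data.Rational using (ℚ; 0ℚ; 1ℚ; -_; _+_; _*_; _/_)
open import Data.List.Relation.Unary.All using (All)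
open import Relation.Nullary using (does)
open import Relation.Binary.PropositionalEquality using (_≡_)

-- A composition is a list of positive naturals; |α| = sum α, l(α) = length α.
IsComposition : List ℕ → Set
IsComposition α = All (λ a → 0 ℕ.< a) α

_==ᴸ_ : List ℕ → List ℕ → Bool
xs ==ᴸ ys = does (≡-dec ℕ._≟_ xs ys)

-- All compositions α with α ≽ β (coarsenings of β, obtained by adding
-- together consecutive parts). Each appears exactly once.
-- coarseningsFrom a β = coarsenings of (a ∷ β)
coarseningsFrom : ℕ → List ℕ → List (List ℕ)
coarseningsFrom a []      = (a ∷ []) ∷ []
coarseningsFrom a (b ∷ β) =
  map (a ∷_) (coarseningsFrom b β) ++ coarseningsFrom (a ℕ.+ b) β

coarsenings : List ℕ → List (List ℕ)
coarsenings []      = [] ∷ []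
coarsenings (a ∷ β) = coarseningsFrom a β

compositions : ℕ → List (List ℕ)
compositions N = coarsenings (replicate N 1)

-- NSym, represented through coordinates in the (free) basis h_α:
-- an element is its coefficient function  α ↦ coefficient of h_α.

NSym : Set
NSym = List ℕ → ℚ

_≈_ : NSym → NSym → Set
f ≈ g = ∀ γ → f γ ≡ g γ

0N : NSym
0N _ = 0ℚ

_⊕_ : NSym → NSym → NSym
(f ⊕ g) γ = f γ + g γ

_·_ : ℚ → NSym → NSym
(c · f) γ = c * f γ

ΣN : List NSym → NSym
ΣN = foldr _⊕_ 0N

h : List ℕ → NSym
h α γ = if γ ==ᴸ α then 1ℚ else 0ℚ

sign : ℕ → ℚ
sign zero          = 1ℚ
sign (suc zero)    = - 1ℚ
sign (suc (suc k)) = sign k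

fromℕ : ℕ → ℚ
fromℕ n = + n / 1

r : List ℕ → NSym
r β = ΣN (map (λ α → sign (length β ∸ length α) · h α) (coarsenings β))

-- rows top to bottom, each row left to right; indices below are 0-based
Filling : Set
Filling = List (List ℕ)

at : {A : Set} → List A → ℕ → Maybe A
at []       _       = nothing
at (x ∷ _)  zero    = just x
at (_ ∷ xs) (suc i) = at xs i

cell : Filling → ℕ → ℕ → Maybe ℕ
cell T i j with at T i
... | nothing = nothing
... | just row = at row j

upTo : ℕ → List ℕ
upTo zero    = []
upTo (suc n) = upTo n ++ (n ∷ [])

range1 : ℕ → List ℕ
range1 n = map suc (upTo n)

allB : {A : Set} → (A → Bool) → List A → Bool
allB p = foldr (λ x b → p x ∧ b) true

strictDec : List ℕ → Bool
strictDec []            = true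
strictDec (x ∷ [])      = true
strictDec (x ∷ y ∷ xs)  = (y <ᵇ x) ∧ strictDec (y ∷ xs)

strictInc : List ℕ → Bool
strictInc []            = true
strictInc (x ∷ [])      = true
strictInc (x ∷ y ∷ xs)  = (x <ᵇ y) ∧ strictInc (y ∷ xs)

firstColumn : Filling → List ℕ
firstColumn []             = []
firstColumn ([] ∷ T)       = firstColumn T
firstColumn ((x ∷ _) ∷ T)  = x ∷ firstColumn T

-- the triple condition for rows i < i' and (0-based) columns c, c+1:
-- if (i',c+1) and (i,c) are boxes with τ(i,c) ≥ τ(i',c+1), then (i,c+1)
-- is a box and τ(i,c+1) > τ(i',c+1)
tripleAt : Filling → ℕ → ℕ → ℕ → Bool
tripleAt T i i' c with cell T i' (suc c) | cell T i c
... | just v | just u = if v ≤ᵇ u then check (cell T i (suc c)) else true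
  where
  check : Maybe ℕ → Bool
  check (just w) = v <ᵇ w
  check nothing  = false
... | _ | _ = true

isSRCT : Filling → Bool
isSRCT T =
  allB strictDec T ∧ strictInc (firstColumn T) ∧
  allB (λ i' → allB (λ i → if i <ᵇ i'
                            then allB (tripleAt T i i') (upTo N)
                            else true) (upTo (length T))) (upTo (length T))
  where N = sum (map length T)

columnIn : List ℕ → ℕ → Maybe ℕ
columnIn []       m = nothing
columnIn (x ∷ xs) m = if x ℕ.≡ᵇ m then just 0 else Data.Maybe.map suc (columnIn xs m)
  where import Data.Maybe

column : Filling → ℕ → Maybe ℕ
column []      m = nothing
column (ρ ∷ T) m with columnIn ρ m
... | just c  = just c
... | nothing = column T m

isDescent : Filling → ℕ → Bool
isDescent T m with column T m | column T (suc m)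
... | just c | just c' = c ≤ᵇ c'
... | _      | _       = false

descentSet : Filling → List ℕ
descentSet T = filter (λ m → isDescent T m Data.Bool.≟ true) (range1 (sum (map length T) ∸ 1))
  where import Data.Bool

-- partial sums β₁, β₁+β₂, …, β₁+…+β_{k-1} (i.e. the set associated with β)
partialSums : List ℕ → List ℕ
partialSums []           = []
partialSums (a ∷ [])     = []
partialSums (a ∷ b ∷ β)  = a ∷ map (a ℕ.+_) (partialSums (b ∷ β))

insertions : ℕ → List ℕ → List (List ℕ)
insertions x []       = (x ∷ []) ∷ []
insertions x (y ∷ ys) = (x ∷ y ∷ ys) ∷ map (y ∷_) (insertions x ys)

permutations : List ℕ → List (List ℕ)
permutations []       = [] ∷ []
permutations (x ∷ xs) = concatMap (insertions x) (permutations xs)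

cut : List ℕ → List ℕ → Filling
cut []      w = []
cut (a ∷ α) w = take a w ∷ cut α (drop a w)

fillings : List ℕ → List Filling
fillings α = map (cut α) (permutations (range1 (sum α)))

d : List ℕ → List ℕ → ℕ
d α β = length (filter (λ T → (isSRCT T ∧ (sum α ℕ.≡ᵇ sum β) ∧ (descentSet T ==ᴸ partialSums β)) Data.Bool.≟ true) (fillings α))
  where import Data.Bool

-- The defining relations of the noncommutative Schur functions:
--   r_β = Σ_{α ⊨ |β|} d_{α,β} s_α   for every composition β.
IsNCSchur : (List ℕ → NSym) → Set
IsNCSchur s = ∀ β → IsComposition β →
  r β ≈ ΣN (map (λ α → fromℕ (d α β) · s α) (compositions (sum β)))

-- the composition (n); for n = 0 this is the empty composition
single : ℕ → List ℕ
single zero    = []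
single (suc n) = suc n ∷ []

-- Expanding r_β = Σ_α d_{α,β} s_α, it suffices that d_{β,β} = 1 and d_{α,β} = 0 for every other
-- composition α of |β| when β is (n) or (1^n). A tableau counted by d_{α,(n)} has no descents, so
-- its entries n, n-1, …, 1 move strictly rightwards: α is the single row (n), and the only such
-- tableau is the decreasing row. A tableau counted by d_{α,(1^n)} has every m as a descent, so
-- entries never move left as m grows; a row beginning y > x would put x in column 1 and y in
-- column 0, so α = (1^n), and the only such tableau is the increasing column. In both cases
-- exactly one of the n! fillings of the diagram qualifies.

module Submission where

open import Defs
open import Data.Bool using (Bool; true; false; _∧_; if_then_else_)
import Data.Bool as Bool
open import Data.Bool.Properties using (T-≡; ¬-not; ∧-zeroʳ; ∧-identityʳ; ∧-conicalˡ; ∧-conicalʳ)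
open import Data.Empty using (⊥; ⊥-elim)
open import Data.List as List
  using (List; []; _∷_; _++_; map; concat; concatMap; replicate; length; take; drop; filter; applyUpTo)
import Data.List.Properties as Listₚ
open import Data.List.Membership.Propositional using (_∈_; _∉_; find)
open import Data.List.Membership.Propositional.Properties
  using (∈-applyUpTo⁺; ∈-applyUpTo⁻; ∈-++⁻; ∈-concat⁺′; ∈-filter⁺; ∈-filter⁻)
open import Data.List.Relation.Binary.Permutation.Propositional
  using (_↭_; ↭-refl; ↭-prep; ↭-swap; ↭-trans; ↭-sym; ↭⇒↭ₛ)
open import Data.List.Relation.Binary.Permutation.Propositional.Properties
  using (All-resp-↭; ∈-resp-↭; ↭-length)
import Data.List.Relation.Binary.Permutation.Setoid.Properties as Permₛ
open import Data.List.Relation.Unary.All as All using (All; []; _∷_)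
import Data.List.Relation.Unary.All.Properties as Allₚ
open import Data.List.Relation.Unary.AllPairs as AllPairs using (AllPairs; []; _∷_)
import Data.List.Relation.Unary.AllPairs.Properties as AllPairsₚ
open import Data.List.Relation.Unary.Any as Any using (Any; here; there)
open import Data.List.Relation.Unary.Unique.Propositional using (Unique)
open import Data.Maybe as Maybe using (Maybe; just; nothing)
open import Data.Maybe.Properties using (just-injective)
open import Data.Nat as ℕ using (ℕ; zero; suc; _≤_; _<_; z≤n; s≤s; z<s; _<ᵇ_)
import Data.Nat.Properties as ℕₚ
open import Data.Nat.ListAction using (sum)
open import Data.Product using (∃; _×_; _,_; proj₁; proj₂)
open import Data.Rational using (0ℚ; 1ℚ; _*_)
import Data.Rational.Properties as ℚₚ
open import Data.Sum using (inj₁; inj₂)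
open import Function using (_∘_; case_of_)
open import Function.Bundles using (Equivalence)
open import Relation.Binary.PropositionalEquality using (_≡_; _≢_; refl; sym; trans; cong; subst)
import Relation.Binary.PropositionalEquality as ≡
open import Relation.Nullary using (¬_; yes; no)

<ᵇ≡true⇒< : ∀ {m n} → (m <ᵇ n) ≡ true → m < n
<ᵇ≡true⇒< {m} {n} e = ℕₚ.<ᵇ⇒< m n (Equivalence.from T-≡ e)

<⇒<ᵇ≡true : ∀ {m n} → m < n → (m <ᵇ n) ≡ true
<⇒<ᵇ≡true m<n = Equivalence.to T-≡ (ℕₚ.<⇒<ᵇ m<n)

≤⇒<ᵇ≡false : ∀ {m n} → n ≤ m → (m <ᵇ n) ≡ false
≤⇒<ᵇ≡false n≤m = ¬-not λ e → ℕₚ.<⇒≱ (<ᵇ≡true⇒< e) n≤m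

≡ᵇ-refl : ∀ n → (n ℕ.≡ᵇ n) ≡ true
≡ᵇ-refl n = Equivalence.to T-≡ (ℕₚ.≡⇒≡ᵇ n n refl)

≢⇒≡ᵇ≡false : ∀ {m n} → m ≢ n → (m ℕ.≡ᵇ n) ≡ false
≢⇒≡ᵇ≡false {m} {n} m≢n = ¬-not λ e → m≢n (ℕₚ.≡ᵇ⇒≡ m n (Equivalence.from T-≡ e))

true≢false : true ≢ false
true≢false ()

==ᴸ⇒≡ : ∀ {xs ys} → (xs ==ᴸ ys) ≡ true → xs ≡ ys
==ᴸ⇒≡ {xs} {ys} e with Listₚ.≡-dec ℕ._≟_ xs ys
... | yes xs≡ys = xs≡ys

==ᴸ-refl : ∀ xs → (xs ==ᴸ xs) ≡ true
==ᴸ-refl xs with Listₚ.≡-dec ℕ._≟_ xs xs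
... | yes _   = refl
... | no  xs≢xs = ⊥-elim (xs≢xs refl)

if-else-true : ∀ b {x} → x ≡ true → (if b then x else true) ≡ true
if-else-true true  e = e
if-else-true false _ = refl

allB-∈ : ∀ {A : Set} (p : A → Bool) {xs x} → allB p xs ≡ true → x ∈ xs → p x ≡ true
allB-∈ p {y ∷ xs} all (here refl) = ∧-conicalˡ (p y) _ all
allB-∈ p {y ∷ xs} all (there x∈)  = allB-∈ p (∧-conicalʳ (p y) _ all) x∈

allB-All : ∀ {A : Set} (p : A → Bool) xs → All (λ x → p x ≡ true) xs → allB p xs ≡ true
allB-All p []       []       = refl
allB-All p (x ∷ xs) (e ∷ es) rewrite e = allB-All p xs es

≤pred⇒< : ∀ {m n} → 1 ≤ m → m ≤ ℕ.pred n → m < n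
≤pred⇒< {n = suc n} _ m≤n = s≤s m≤n
≤pred⇒< {n = zero}  (s≤s _) ()

count : {A : Set} → (A → Bool) → List A → ℕ
count p []       = 0
count p (x ∷ xs) = if p x then suc (count p xs) else count p xs

count-++ : ∀ {A : Set} (p : A → Bool) xs ys → count p (xs ++ ys) ≡ count p xs ℕ.+ count p ys
count-++ p []       ys = refl
count-++ p (x ∷ xs) ys with p x
... | true  = cong suc (count-++ p xs ys)
... | false = count-++ p xs ys

count-map : ∀ {A B : Set} (p : B → Bool) (f : A → B) xs → count p (map f xs) ≡ count (λ x → p (f x)) xs
count-map p f []       = refl
count-map p f (x ∷ xs) with p (f x)
... | true  = cong suc (count-map p f xs)
... | false = count-map p f xs

count-cong : ∀ {A : Set} {p q : A → Bool} {xs} → All (λ x → p x ≡ q x) xs → count p xs ≡ count q xs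
count-cong         {xs = []}     []       = refl
count-cong {q = q} {xs = x ∷ xs} (e ∷ es) rewrite e with q x
... | true  = cong suc (count-cong es)
... | false = count-cong es

count-none : ∀ {A : Set} {p : A → Bool} {xs} → All (λ x → p x ≡ false) xs → count p xs ≡ 0
count-none {xs = []}     []       = refl
count-none {xs = x ∷ xs} (e ∷ es) rewrite e = count-none es

count-concatMap : ∀ {A B : Set} (p : B → Bool) (q : A → Bool) (f : A → List B) xs →
  All (λ x → count p (f x) ≡ (if q x then 1 else 0)) xs → count p (concatMap f xs) ≡ count q xs
count-concatMap p q f []       []       = refl
count-concatMap p q f (x ∷ xs) (e ∷ es)
  rewrite count-++ p (f x) (concatMap f xs) | e | count-concatMap p q f xs es with q x
... | true  = refl
... | false = refl

length-filter≡count : ∀ {A : Set} (p : A → Bool) xs → length (filter (λ x → p x Bool.≟ true) xs) ≡ count p xs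
length-filter≡count p []       = refl
length-filter≡count p (x ∷ xs) with p x
... | true  = cong suc (length-filter≡count p xs)
... | false = length-filter≡count p xs

insertions-↭ : ∀ (x : ℕ) p → All (_↭ x ∷ p) (insertions x p)
insertions-↭ x []       = ↭-refl ∷ []
insertions-↭ x (y ∷ ys) =
  ↭-refl ∷ Allₚ.map⁺ (All.map (λ q↭ → ↭-trans (↭-prep y q↭) (↭-swap y x ↭-refl)) (insertions-↭ x ys))

permutations-↭ : ∀ xs → All (_↭ xs) (permutations xs)
permutations-↭ []       = ↭-refl ∷ []
permutations-↭ (x ∷ xs) = Allₚ.concat⁺ (Allₚ.map⁺ (All.map
  (λ {p} p↭ → All.map (λ q↭ → ↭-trans q↭ (↭-prep x p↭)) (insertions-↭ x p))
  (permutations-↭ xs)))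

∈-insertions : ∀ (x : ℕ) p → All (x ∈_) (insertions x p)
∈-insertions x p = All.map (λ q↭ → ∈-resp-↭ (↭-sym q↭) (here refl)) (insertions-↭ x p)

strictInc-∷-false : ∀ {x y} q → x < y → x ∈ q → strictInc (y ∷ q) ≡ false
strictInc-∷-false {x} {y} (z ∷ zs) x<y x∈ with y <ᵇ z in y<ᵇz | x∈
... | false | _          = refl
... | true  | here refl  = ⊥-elim (ℕₚ.<-asym x<y (<ᵇ≡true⇒< y<ᵇz))
... | true  | there x∈zs = strictInc-∷-false zs (ℕₚ.<-trans x<y (<ᵇ≡true⇒< y<ᵇz)) x∈zs

-- Inserting a new minimum keeps a list increasing only in front.
insertions-strictInc : ∀ x p → All (x <_) p →
  count strictInc (insertions x p) ≡ (if strictInc p then 1 else 0)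
insertions-strictInc x []       []         = refl
insertions-strictInc x (y ∷ ys) (x<y ∷ _)
  rewrite <⇒<ᵇ≡true x<y
  = cong (λ n → if strictInc (y ∷ ys) then suc n else n)
         (count-none (Allₚ.map⁺ (All.map (λ {q} → strictInc-∷-false q x<y) (∈-insertions x ys))))

insertions-strictDec-∷ : ∀ {x y} ys → x < y → All (x <_) ys →
  count (λ q → strictDec (y ∷ q)) (insertions x ys) ≡ (if strictDec (y ∷ ys) then 1 else 0)
insertions-strictDec-∷ []       x<y [] rewrite <⇒<ᵇ≡true x<y = refl
insertions-strictDec-∷ {x} {y} (z ∷ zs) x<y (x<z ∷ x<zs)
  rewrite ≤⇒<ᵇ≡false {z} {x} (ℕₚ.<⇒≤ x<z) | ∧-zeroʳ (x <ᵇ y)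
        | count-map (λ q → strictDec (y ∷ q)) (z ∷_) (insertions x zs)
  with z <ᵇ y
... | true  = insertions-strictDec-∷ zs x<z x<zs
... | false = count-none {xs = insertions x zs} (All.tabulate λ _ → refl)

-- Inserting a new minimum keeps a list decreasing only at the end.
insertions-strictDec : ∀ x p → All (x <_) p →
  count strictDec (insertions x p) ≡ (if strictDec p then 1 else 0)
insertions-strictDec x []       []          = refl
insertions-strictDec x (y ∷ ys) (x<y ∷ x<ys)
  rewrite ≤⇒<ᵇ≡false {y} {x} (ℕₚ.<⇒≤ x<y)
        | count-map strictDec (y ∷_) (insertions x ys)
  = insertions-strictDec-∷ ys x<y x<ys

module _ (order : List ℕ → Bool)
         (insertions-order : ∀ x p → All (x <_) p →
            count order (insertions x p) ≡ (if order p then 1 else 0)) where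

  count-permutations-of-sorted : ∀ xs → AllPairs _<_ xs → order [] ≡ true →
    count order (permutations xs) ≡ 1
  count-permutations-of-sorted []       []              e rewrite e = refl
  count-permutations-of-sorted (x ∷ xs) (x<xs ∷ sorted) e =
    trans (count-concatMap order order (insertions x) (permutations xs)
            (All.map (λ p↭ → insertions-order x _ (All-resp-↭ (↭-sym p↭) x<xs)) (permutations-↭ xs)))
          (count-permutations-of-sorted xs sorted e)

upTo≡List-upTo : ∀ n → upTo n ≡ List.upTo n
upTo≡List-upTo zero    = refl
upTo≡List-upTo (suc n) = trans (cong (_++ n ∷ []) (upTo≡List-upTo n)) (Listₚ.upTo-∷ʳ n)

range1≡applyUpTo-suc : ∀ n → range1 n ≡ applyUpTo suc n
range1≡applyUpTo-suc n = trans (cong (map suc) (upTo≡List-upTo n)) (Listₚ.map-upTo suc n)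

range1-suc : ∀ n → range1 (suc n) ≡ 1 ∷ map suc (range1 n)
range1-suc n rewrite range1≡applyUpTo-suc (suc n) | range1≡applyUpTo-suc n =
  cong (1 ∷_) (sym (Listₚ.map-applyUpTo suc suc n))

length-range1 : ∀ n → length (range1 n) ≡ n
length-range1 n rewrite range1≡applyUpTo-suc n = Listₚ.length-applyUpTo suc n

range1-sorted : ∀ n → AllPairs _<_ (range1 n)
range1-sorted n rewrite range1≡applyUpTo-suc n = AllPairsₚ.applyUpTo⁺₁ suc n (λ i<j _ → s≤s i<j)

∈-range1⁺ : ∀ {m n} → 1 ≤ m → m ≤ n → m ∈ range1 n
∈-range1⁺ {suc m} {n} _ m<n rewrite range1≡applyUpTo-suc n = ∈-applyUpTo⁺ suc m<n

∈-range1⁻ : ∀ {m n} → m ∈ range1 n → 1 ≤ m × m ≤ n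
∈-range1⁻ {m} {n} m∈ rewrite range1≡applyUpTo-suc n with ∈-applyUpTo⁻ suc m∈
... | _ , i<n , refl = s≤s z≤n , i<n

module _ {M w} (w↭ : w ↭ range1 M) where

  length-↭-range1 : length w ≡ M
  length-↭-range1 = trans (↭-length w↭) (length-range1 M)

  ∈-↭-range1⁺ : ∀ {m} → 1 ≤ m → m ≤ M → m ∈ w
  ∈-↭-range1⁺ 1≤m m≤M = ∈-resp-↭ (↭-sym w↭) (∈-range1⁺ 1≤m m≤M)

  ∈-↭-range1⁻ : ∀ {m} → m ∈ w → 1 ≤ m × m ≤ M
  ∈-↭-range1⁻ m∈w = ∈-range1⁻ (∈-resp-↭ w↭ m∈w)

  unique-↭-range1 : Unique w
  unique-↭-range1 = Permₛ.Unique-resp-↭ (≡.setoid ℕ) (↭⇒↭ₛ (↭-sym w↭))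
    (AllPairs.map ℕₚ.<⇒≢ (range1-sorted M))

sum-ones : ∀ n → sum (replicate n 1) ≡ n
sum-ones zero    = refl
sum-ones (suc n) = cong suc (sum-ones n)

partialSums-ones : ∀ n → partialSums (replicate n 1) ≡ range1 (n ℕ.∸ 1)
partialSums-ones zero          = refl
partialSums-ones (suc zero)    = refl
partialSums-ones (suc (suc n)) =
  trans (cong (λ ps → 1 ∷ map suc ps) (partialSums-ones (suc n))) (sym (range1-suc n))

partialSums-single : ∀ n → partialSums (single n) ≡ []
partialSums-single zero    = refl
partialSums-single (suc n) = refl

coarseningsFrom-compositions : ∀ {a} β → 0 < a → IsComposition β → All IsComposition (coarseningsFrom a β)
coarseningsFrom-compositions         []      0<a []          = (0<a ∷ []) ∷ []
coarseningsFrom-compositions {a} (b ∷ β) 0<a (0<b ∷ β⁺) =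
  Allₚ.++⁺ (Allₚ.map⁺ (All.map (0<a ∷_) (coarseningsFrom-compositions β 0<b β⁺)))
           (coarseningsFrom-compositions β (ℕₚ.<-≤-trans 0<a (ℕₚ.m≤m+n a b)) β⁺)

coarseningsFrom-nonempty : ∀ a β → All (λ α → 1 ≤ length α) (coarseningsFrom a β)
coarseningsFrom-nonempty a []      = s≤s z≤n ∷ []
coarseningsFrom-nonempty a (b ∷ β) =
  Allₚ.++⁺ (Allₚ.map⁺ (All.tabulate λ _ → s≤s z≤n)) (coarseningsFrom-nonempty (a ℕ.+ b) β)

coarseningsFrom-∷ʳ-single : ∀ a β → ∃ λ L →
  coarseningsFrom a β ≡ L ++ (a ℕ.+ sum β ∷ []) ∷ [] × All (λ α → 2 ≤ length α) L
coarseningsFrom-∷ʳ-single a []      rewrite ℕₚ.+-identityʳ a = [] , refl , []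
coarseningsFrom-∷ʳ-single a (b ∷ β) with coarseningsFrom-∷ʳ-single (a ℕ.+ b) β
... | L , eq , long rewrite eq | ℕₚ.+-assoc a b (sum β) =
  map (a ∷_) (coarseningsFrom b β) ++ L ,
  sym (Listₚ.++-assoc (map (a ∷_) (coarseningsFrom b β)) L _) ,
  Allₚ.++⁺ (Allₚ.map⁺ (All.map s≤s (coarseningsFrom-nonempty b β))) long

coarseningsFrom-has-part-≥ : ∀ a β → All (Any (a ≤_)) (coarseningsFrom a β)
coarseningsFrom-has-part-≥ a []      = here ℕₚ.≤-refl ∷ []
coarseningsFrom-has-part-≥ a (b ∷ β) =
  Allₚ.++⁺ (Allₚ.map⁺ (All.tabulate λ _ → here ℕₚ.≤-refl))
           (All.map (Any.map (ℕₚ.≤-trans (ℕₚ.m≤m+n a b))) (coarseningsFrom-has-part-≥ (a ℕ.+ b) β))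

coarseningsFrom-ones : ∀ k → ∃ λ L →
  coarseningsFrom 1 (replicate k 1) ≡ replicate (suc k) 1 ∷ L × All (Any (2 ≤_)) L
coarseningsFrom-ones zero    = [] , refl , []
coarseningsFrom-ones (suc k) with coarseningsFrom-ones k
... | L , eq , big rewrite eq =
  map (1 ∷_) L ++ coarseningsFrom 2 (replicate k 1) , refl ,
  Allₚ.++⁺ (Allₚ.map⁺ (All.map there big)) (coarseningsFrom-has-part-≥ 2 (replicate k 1))

single-composition : ∀ n → IsComposition (single n)
single-composition zero    = []
single-composition (suc n) = s≤s z≤n ∷ []

compositions-single : ∀ n → ∃ λ L → compositions (sum (single n)) ≡ L ++ single n ∷ [] ×
  All (λ α → IsComposition α × 2 ≤ length α) L
compositions-single zero    = [] , refl , []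
compositions-single (suc k) rewrite ℕₚ.+-identityʳ k with coarseningsFrom-∷ʳ-single 1 (replicate k 1)
... | L , eq , long rewrite sum-ones k =
  L , eq , All.zip (Allₚ.++⁻ˡ L (subst (All IsComposition) eq
                     (coarseningsFrom-compositions (replicate k 1) (s≤s z≤n) (Allₚ.replicate⁺ k (s≤s z≤n)))) , long)

compositions-ones : ∀ n → ∃ λ L → compositions (sum (replicate n 1)) ≡ replicate n 1 ∷ L ×
  All (Any (2 ≤_)) L
compositions-ones zero    = [] , refl , []
compositions-ones (suc k) rewrite sum-ones k = coarseningsFrom-ones k

-- Expansion of ribbons in noncommutative Schur functions

ΣN-map-vanishing : ∀ (g : List ℕ → NSym) γ L → All (λ α → g α γ ≡ 0ℚ) L → ΣN (map g L) γ ≡ 0ℚ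
ΣN-map-vanishing g γ []      []       = refl
ΣN-map-vanishing g γ (α ∷ L) (e ∷ es) rewrite e | ΣN-map-vanishing g γ L es = refl

ΣN-map-concentrated : ∀ (g : List ℕ → NSym) γ L α L′ →
  All (λ β → g β γ ≡ 0ℚ) L → All (λ β → g β γ ≡ 0ℚ) L′ → ΣN (map g (L ++ α ∷ L′)) γ ≡ g α γ
ΣN-map-concentrated g γ []      α L′ []       es′
  rewrite ΣN-map-vanishing g γ L′ es′ = ℚₚ.+-identityʳ (g α γ)
ΣN-map-concentrated g γ (β ∷ L) α L′ (e ∷ es) es′
  rewrite e | ΣN-map-concentrated g γ L α L′ es es′ = ℚₚ.+-identityˡ (g α γ)

s≈r-if-d-concentrated : ∀ {s} → IsNCSchur s → ∀ {β} L L′ → IsComposition β →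
  compositions (sum β) ≡ L ++ β ∷ L′ → d β β ≡ 1 →
  All (λ α → d α β ≡ 0) L → All (λ α → d α β ≡ 0) L′ → s β ≈ r β
s≈r-if-d-concentrated {s} schur {β} L L′ β⁺ split dββ≡1 vanishL vanishL′ γ = sym (begin
  r β γ                                         ≡⟨ schur β β⁺ γ ⟩
  ΣN (map term (compositions (sum β))) γ         ≡⟨ cong (λ αs → ΣN (map term αs) γ) split ⟩
  ΣN (map term (L ++ β ∷ L′)) γ                  ≡⟨ ΣN-map-concentrated term γ L β L′ (All.map (λ {α} → term-vanishes {α}) vanishL)
                                                                                      (All.map (λ {α} → term-vanishes {α}) vanishL′) ⟩
  fromℕ (d β β) * s β γ                          ≡⟨ cong (λ n → fromℕ n * s β γ) dββ≡1 ⟩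
  1ℚ * s β γ                                     ≡⟨ ℚₚ.*-identityˡ (s β γ) ⟩
  s β γ                                          ∎)
  where
  open ≡.≡-Reasoning
  term : List ℕ → NSym
  term α = fromℕ (d α β) · s α
  term-vanishes : ∀ {α} → d α β ≡ 0 → term α γ ≡ 0ℚ
  term-vanishes {α} dαβ≡0 = trans (cong (λ n → fromℕ n * s α γ) dαβ≡0) (ℚₚ.*-zeroˡ (s α γ))

length-concat : ∀ (T : List (List ℕ)) → length (concat T) ≡ sum (map length T)
length-concat []      = refl
length-concat (ρ ∷ T) = trans (Listₚ.length-++ ρ) (cong (length ρ ℕ.+_) (length-concat T))

length-drop-shape : ∀ a α (w : List ℕ) → length w ≡ a ℕ.+ sum α → length (drop a w) ≡ sum α
length-drop-shape a α w eq = trans (Listₚ.length-drop a w) (trans (cong (ℕ._∸ a) eq) (ℕₚ.m+n∸m≡n a (sum α)))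

concat-cut : ∀ α w → length w ≡ sum α → concat (cut α w) ≡ w
concat-cut []      []      _  = refl
concat-cut (a ∷ α) w       eq =
  trans (cong (take a w ++_) (concat-cut α (drop a w) (length-drop-shape a α w eq)))
        (Listₚ.take++drop≡id a w)

size-cut : ∀ α w → length w ≡ sum α → sum (map length (cut α w)) ≡ sum α
size-cut α w eq = trans (sym (length-concat (cut α w))) (trans (cong length (concat-cut α w eq)) eq)

cut-rows-≤ : ∀ {b} α w → All (_≤ b) α → All (λ ρ → length ρ ≤ b) (cut α w)
cut-rows-≤ []      w []          = []
cut-rows-≤ (a ∷ α) w (a≤b ∷ α≤b) =
  ℕₚ.≤-trans (ℕₚ.≤-reflexive (Listₚ.length-take a w)) (ℕₚ.≤-trans (ℕₚ.m⊓n≤m a (length w)) a≤b)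
  ∷ cut-rows-≤ α (drop a w) α≤b

cut-long-row : ∀ α w → Any (2 ≤_) α → length w ≡ sum α → Any (λ ρ → 2 ≤ length ρ) (cut α w)
cut-long-row (a ∷ α) w (here 2≤a) eq = here (subst (2 ≤_) (sym len-take) 2≤a)
  where
  len-take : length (take a w) ≡ a
  len-take = trans (Listₚ.length-take a w)
               (ℕₚ.m≤n⇒m⊓n≡m (ℕₚ.≤-trans (ℕₚ.m≤m+n a (sum α)) (ℕₚ.≤-reflexive (sym eq))))
cut-long-row (a ∷ α) w (there big) eq = there (cut-long-row α (drop a w) big (length-drop-shape a α w eq))

parts-≤-sum : ∀ α → All (_≤ sum α) α
parts-≤-sum []      = []
parts-≤-sum (a ∷ α) =
  ℕₚ.m≤m+n a (sum α) ∷ All.map (λ b≤ → ℕₚ.≤-trans b≤ (ℕₚ.m≤n+m (sum α) a)) (parts-≤-sum α)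

parts-<-sum : ∀ {α} → IsComposition α → 2 ≤ length α → All (_< sum α) α
parts-<-sum {[]}        _                 ()
parts-<-sum {_ ∷ []}    _                 (s≤s ())
parts-<-sum {x ∷ y ∷ α} (0<x ∷ 0<y ∷ _) _ =
  ℕₚ.m<m+n x (ℕₚ.<-≤-trans 0<y (ℕₚ.m≤m+n y (sum α))) ∷
  All.map (λ b≤ → ℕₚ.≤-<-trans b≤ (ℕₚ.m<n+m (sum (y ∷ α)) 0<x)) (parts-≤-sum (y ∷ α))

at-beyond-length : ∀ {A : Set} (xs : List A) {n} → length xs ≤ n → at xs n ≡ nothing
at-beyond-length []       _         = refl
at-beyond-length (x ∷ xs) (s≤s len) = at-beyond-length xs len

at-∈ : ∀ {A : Set} (xs : List A) i {x} → at xs i ≡ just x → x ∈ xs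
at-∈ (x ∷ xs) zero    refl = here refl
at-∈ (x ∷ xs) (suc i) e    = there (at-∈ xs i e)

columnIn-just⁻ : ∀ ρ {m c} → columnIn ρ m ≡ just c → m ∈ ρ × c < length ρ
columnIn-just⁻ (x ∷ ρ) {m} e with x ℕ.≡ᵇ m in x≡ᵇm | columnIn ρ m in e′ | e
... | true  | _      | refl = here (sym (ℕₚ.≡ᵇ⇒≡ x m (Equivalence.from T-≡ x≡ᵇm))) , s≤s z≤n
... | false | just c | refl = there (proj₁ (columnIn-just⁻ ρ e′)) , s≤s (proj₂ (columnIn-just⁻ ρ e′))

columnIn-present : ∀ ρ {m} → m ∈ ρ → ∃ λ c → columnIn ρ m ≡ just c
columnIn-present (x ∷ ρ) {m} m∈ with x ℕ.≡ᵇ m in x≡ᵇm | m∈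
... | true  | _          = 0 , refl
... | false | here refl  = ⊥-elim (true≢false (trans (sym (≡ᵇ-refl x)) x≡ᵇm))
... | false | there m∈ρ with columnIn-present ρ m∈ρ
...   | c , e rewrite e = suc c , refl

columnIn-absent : ∀ ρ {m} → m ∉ ρ → columnIn ρ m ≡ nothing
columnIn-absent []      _  = refl
columnIn-absent (x ∷ ρ) m∉ rewrite ≢⇒≡ᵇ≡false (λ x≡m → m∉ (here (sym x≡m))) | columnIn-absent ρ (m∉ ∘ there) = refl

columnIn-head : ∀ m w → columnIn (m ∷ w) m ≡ just 0
columnIn-head m w rewrite ≡ᵇ-refl m = refl

columnIn-tail : ∀ {z m} w → z ≢ m → columnIn (z ∷ w) m ≡ Maybe.map suc (columnIn w m)
columnIn-tail w z≢m rewrite ≢⇒≡ᵇ≡false z≢m = refl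

columnIn-second : ∀ {y x} ρ → y ≢ x → columnIn (y ∷ x ∷ ρ) x ≡ just 1
columnIn-second {x = x} ρ y≢x rewrite columnIn-tail (x ∷ ρ) y≢x | columnIn-head x ρ = refl

map-suc≡just⁻ : ∀ mc {c} → Maybe.map suc mc ≡ just c → ∃ λ c₀ → mc ≡ just c₀ × c ≡ suc c₀
map-suc≡just⁻ (just c₀) refl = c₀ , refl , refl

column-present : ∀ T {m} → m ∈ concat T → ∃ λ c → column T m ≡ just c
column-present (ρ ∷ T) {m} m∈ with columnIn ρ m in e | ∈-++⁻ ρ m∈
... | just c  | _         = c , refl
... | nothing | inj₂ m∈T  = column-present T m∈T
... | nothing | inj₁ m∈ρ with columnIn-present ρ m∈ρ
...   | _ , e′ with () ← trans (sym e′) e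

column-bounded : ∀ {b} T {m c} → All (λ ρ → length ρ ≤ b) T → column T m ≡ just c → c < b
column-bounded (ρ ∷ T) {m} (ρ≤b ∷ T≤b) e with columnIn ρ m in e′
... | just c  with refl ← e = ℕₚ.<-≤-trans (proj₂ (columnIn-just⁻ ρ e′)) ρ≤b
... | nothing = column-bounded T T≤b e

unique-++⁻ʳ : ∀ (xs : List ℕ) {ys} → Unique (xs ++ ys) → Unique ys
unique-++⁻ʳ []       u       = u
unique-++⁻ʳ (x ∷ xs) (_ ∷ u) = unique-++⁻ʳ xs u

unique-++-disjoint : ∀ (xs : List ℕ) {ys m} → Unique (xs ++ ys) → m ∈ ys → m ∉ xs
unique-++-disjoint (x ∷ xs) (x∉ ∷ _) m∈ys (here refl) = All.lookup (Allₚ.++⁻ʳ xs x∉) m∈ys refl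
unique-++-disjoint (x ∷ xs) (_ ∷ u)  m∈ys (there m∈xs) = unique-++-disjoint xs u m∈ys m∈xs

column-of-row : ∀ T {ρ m c} → ρ ∈ T → Unique (concat T) → columnIn ρ m ≡ just c → column T m ≡ just c
column-of-row (ρ ∷ T) (here refl) u e rewrite e = refl
column-of-row (ρ′ ∷ T) {ρ} (there ρ∈T) u e
  rewrite columnIn-absent ρ′ (unique-++-disjoint ρ′ u (∈-concat⁺′ (proj₁ (columnIn-just⁻ ρ e)) ρ∈T))
  = column-of-row T ρ∈T (unique-++⁻ʳ ρ′ u) e

isDescent-columns : ∀ T {m c c′} → column T m ≡ just c → column T (suc m) ≡ just c′ →
  isDescent T m ≡ (c ℕ.≤ᵇ c′)
isDescent-columns T e e′ rewrite e | e′ = refl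

isDescent-absent : ∀ T m → column T m ≡ nothing → isDescent T m ≡ false
isDescent-absent T m e rewrite e = refl

isDescent-next-absent : ∀ T m → column T (suc m) ≡ nothing → isDescent T m ≡ false
isDescent-next-absent T m e with column T m
... | just c  rewrite e = refl
... | nothing = refl

descent-next-column : ∀ T {m c} → isDescent T m ≡ true → column T m ≡ just c →
  ∃ λ c′ → column T (suc m) ≡ just c′ × c ≤ c′
descent-next-column T {m} {c} desc e = next (column T (suc m)) refl
  where
  next : ∀ mc → column T (suc m) ≡ mc → ∃ λ c′ → column T (suc m) ≡ just c′ × c ≤ c′
  next (just c′) e′ = c′ , e′ , ℕₚ.≤ᵇ⇒≤ c c′ (Equivalence.from T-≡ (trans (sym (isDescent-columns T e e′)) desc))
  next nothing   e′ with () ← trans (sym desc) (isDescent-next-absent T m e′)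

non-descent-next-column : ∀ T {m c c′} → isDescent T m ≡ false → column T m ≡ just c →
  column T (suc m) ≡ just c′ → c′ < c
non-descent-next-column T {c = c} {c′} asc e e′ =
  ℕₚ.≰⇒> λ c≤c′ → true≢false (trans (sym (Equivalence.to T-≡ (ℕₚ.≤⇒≤ᵇ c≤c′)))
                                     (trans (sym (isDescent-columns T e e′)) asc))

column-weakly-increasing-along-descents : ∀ T a k {c} →
  (∀ m → a ≤ m → m < a ℕ.+ k → isDescent T m ≡ true) → column T a ≡ just c →
  ∃ λ c′ → column T (a ℕ.+ k) ≡ just c′ × c ≤ c′
column-weakly-increasing-along-descents T a zero {c} _ e rewrite ℕₚ.+-identityʳ a = c , e , ℕₚ.≤-refl
column-weakly-increasing-along-descents T a (suc k) desc e
  with descent-next-column T (desc a ℕₚ.≤-refl (ℕₚ.m<m+n a z<s)) e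
... | c₁ , e₁ , c≤c₁ rewrite ℕₚ.+-suc a k
  with column-weakly-increasing-along-descents T (suc a) k (λ m a<m m<a+k → desc m (ℕₚ.<⇒≤ a<m) m<a+k) e₁
... | c′ , e′ , c₁≤c′ = c′ , e′ , ℕₚ.≤-trans c≤c₁ c₁≤c′

-- Presence of every entry makes each non-descent a strict move to the left.
column-decreasing-along-non-descents : ∀ T a k {c} →
  (∀ m → a ≤ m → m ≤ a ℕ.+ k → m ∈ concat T) →
  (∀ m → a ≤ m → m < a ℕ.+ k → isDescent T m ≡ false) → column T (a ℕ.+ k) ≡ just c →
  ∃ λ c′ → column T a ≡ just c′ × k ℕ.+ c ≤ c′
column-decreasing-along-non-descents T a zero {c} _ _ e rewrite ℕₚ.+-identityʳ a = c , e , ℕₚ.≤-refl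
column-decreasing-along-non-descents T a (suc k) present asc e rewrite ℕₚ.+-suc a k
  with column-decreasing-along-non-descents T (suc a) k
         (λ m a<m m≤ → present m (ℕₚ.<⇒≤ a<m) m≤) (λ m a<m m< → asc m (ℕₚ.<⇒≤ a<m) m<) e
... | c₁ , e₁ , k+c≤c₁ with column-present T (present a ℕₚ.≤-refl (ℕₚ.m≤n⇒m≤1+n (ℕₚ.m≤m+n a k)))
... | c₀ , e₀ =
  c₀ , e₀ , ℕₚ.≤-trans (s≤s k+c≤c₁) (non-descent-next-column T (asc a ℕₚ.≤-refl (s≤s (ℕₚ.m≤m+n a k))) e₀ e₁)

descentSet-descent : ∀ T {m} → m ∈ descentSet T → isDescent T m ≡ true
descentSet-descent T m∈ = proj₂ (∈-filter⁻ (λ m → isDescent T m Bool.≟ true) {xs = range1 (sum (map length T) ℕ.∸ 1)} m∈)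

∈-descentSet : ∀ T {m} → 1 ≤ m → m ≤ sum (map length T) ℕ.∸ 1 → isDescent T m ≡ true → m ∈ descentSet T
∈-descentSet T 1≤m m≤ desc = ∈-filter⁺ (λ m → isDescent T m Bool.≟ true) (∈-range1⁺ 1≤m m≤) desc

-- Definitionally the condition filtered in the definition of d.
srctWithDescents : List ℕ → List ℕ → Filling → Bool
srctWithDescents α β T = isSRCT T ∧ (sum α ℕ.≡ᵇ sum β) ∧ (descentSet T ==ᴸ partialSums β)

srctWithDescents⁻ : ∀ α β T → srctWithDescents α β T ≡ true →
  isSRCT T ≡ true × sum α ≡ sum β × descentSet T ≡ partialSums β
srctWithDescents⁻ α β T e =
  ∧-conicalˡ (isSRCT T) _ e ,
  ℕₚ.≡ᵇ⇒≡ (sum α) (sum β) (Equivalence.from T-≡ (∧-conicalˡ (sum α ℕ.≡ᵇ sum β) _ sizes&descents)) ,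
  ==ᴸ⇒≡ (∧-conicalʳ (sum α ℕ.≡ᵇ sum β) _ sizes&descents)
  where
  sizes&descents : ((sum α ℕ.≡ᵇ sum β) ∧ (descentSet T ==ᴸ partialSums β)) ≡ true
  sizes&descents = ∧-conicalʳ (isSRCT T) _ e

d≡count : ∀ α β (q : List ℕ → Bool) →
  (∀ {w} → w ↭ range1 (sum α) → srctWithDescents α β (cut α w) ≡ q w) →
  d α β ≡ count q (permutations (range1 (sum α)))
d≡count α β q agree = begin
  d α β                                                          ≡⟨ length-filter≡count (srctWithDescents α β) (fillings α) ⟩
  count (srctWithDescents α β) (fillings α)                      ≡⟨ count-map (srctWithDescents α β) (cut α) words ⟩
  count (λ w → srctWithDescents α β (cut α w)) words              ≡⟨ count-cong (All.map agree (permutations-↭ (range1 (sum α)))) ⟩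
  count q words                                                  ∎
  where
  open ≡.≡-Reasoning
  words : List (List ℕ)
  words = permutations (range1 (sum α))

d≡0 : ∀ α β → (∀ {w} → w ↭ range1 (sum α) → srctWithDescents α β (cut α w) ≢ true) → d α β ≡ 0
d≡0 α β none = trans (d≡count α β (λ _ → false) (¬-not ∘ none))
                        (count-none {xs = permutations (range1 (sum α))} (All.tabulate λ _ → refl))

-- A single row

strictDec-head : ∀ z w → strictDec (z ∷ w) ≡ true → All (_< z) w
strictDec-head z []       _   = []
strictDec-head z (y ∷ ys) dec =
  y<z ∷ All.map (λ u<y → ℕₚ.<-trans u<y y<z) (strictDec-head y ys (∧-conicalʳ (y <ᵇ z) _ dec))
  where
  y<z : y < z
  y<z = <ᵇ≡true⇒< (∧-conicalˡ (y <ᵇ z) _ dec)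

strictDec-tail : ∀ z w → strictDec (z ∷ w) ≡ true → strictDec w ≡ true
strictDec-tail z []       _   = refl
strictDec-tail z (y ∷ ys) dec = ∧-conicalʳ (y <ᵇ z) _ dec

columnIn-strictDec : ∀ ρ {m c c′} → strictDec ρ ≡ true →
  columnIn ρ m ≡ just c → columnIn ρ (suc m) ≡ just c′ → c′ < c
columnIn-strictDec (z ∷ w) {m} dec e e′ with z ℕ.≟ m
... | yes refl with map-suc≡just⁻ (columnIn w (suc z)) (trans (sym (columnIn-tail w (ℕₚ.1+n≢n ∘ sym))) e′)
...   | _ , e₁ , _ =
  ⊥-elim (ℕₚ.1+n≰n (ℕₚ.<⇒≤ (All.lookup (strictDec-head z w dec) (proj₁ (columnIn-just⁻ w e₁)))))
columnIn-strictDec (z ∷ w) {m} dec e e′ | no z≢m with map-suc≡just⁻ (columnIn w m) (trans (sym (columnIn-tail w z≢m)) e)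
... | c₀ , e₀ , refl with z ℕ.≟ suc m
...   | yes refl with refl ← trans (sym (columnIn-head (suc m) w)) e′ = s≤s z≤n
...   | no z≢1+m with map-suc≡just⁻ (columnIn w (suc m)) (trans (sym (columnIn-tail w z≢1+m)) e′)
...     | c₁ , e₁ , refl = s≤s (columnIn-strictDec w (strictDec-tail z w dec) e₀ e₁)

column-single-row : ∀ ρ m → column (ρ ∷ []) m ≡ columnIn ρ m
column-single-row ρ m with columnIn ρ m
... | just _  = refl
... | nothing = refl

single-decreasing-row-no-descent : ∀ ρ m → strictDec ρ ≡ true → isDescent (ρ ∷ []) m ≢ true
single-decreasing-row-no-descent ρ m dec desc = from-column (column (ρ ∷ []) m) refl
  where
  from-column : ∀ mc → column (ρ ∷ []) m ≡ mc → ⊥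
  from-column nothing  e = true≢false (trans (sym desc) (isDescent-absent (ρ ∷ []) m e))
  from-column (just c) e with descent-next-column (ρ ∷ []) desc e
  ... | c′ , e′ , c≤c′ = ℕₚ.<⇒≱ (columnIn-strictDec ρ dec (trans (sym (column-single-row ρ m)) e)
                                   (trans (sym (column-single-row ρ (suc m))) e′)) c≤c′

descentSet-single-decreasing-row : ∀ ρ → strictDec ρ ≡ true → descentSet (ρ ∷ []) ≡ []
descentSet-single-decreasing-row ρ dec =
  Listₚ.filter-none (λ m → isDescent (ρ ∷ []) m Bool.≟ true) {xs = range1 (length ρ ℕ.+ 0 ℕ.∸ 1)}
    (All.tabulate λ {m} _ → single-decreasing-row-no-descent ρ m dec)

isSRCT-single-row : ∀ ρ → isSRCT (ρ ∷ []) ≡ strictDec ρ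
isSRCT-single-row []      = refl
isSRCT-single-row (x ∷ ρ) with strictDec (x ∷ ρ)
... | true  = refl
... | false = refl

srctWithDescents-single-row : ∀ N ρ → srctWithDescents (N ∷ []) (N ∷ []) (ρ ∷ []) ≡ strictDec ρ
srctWithDescents-single-row N ρ rewrite isSRCT-single-row ρ | ≡ᵇ-refl (N ℕ.+ 0) with strictDec ρ in dec
... | false = refl
... | true  rewrite descentSet-single-decreasing-row ρ dec = refl

d-one-row : ∀ N → d (N ∷ []) (N ∷ []) ≡ 1
d-one-row N =
  trans (d≡count (N ∷ []) (N ∷ []) strictDec agree)
        (count-permutations-of-sorted strictDec insertions-strictDec (range1 (N ℕ.+ 0)) (range1-sorted (N ℕ.+ 0)) refl)
  where
  agree : ∀ {w} → w ↭ range1 (N ℕ.+ 0) → srctWithDescents (N ∷ []) (N ∷ []) (cut (N ∷ []) w) ≡ strictDec w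
  agree {w} w↭ rewrite Listₚ.take-all N w (ℕₚ.≤-reflexive (trans (length-↭-range1 w↭) (ℕₚ.+-identityʳ N))) =
    srctWithDescents-single-row N w

d-single : ∀ n → d (single n) (single n) ≡ 1
d-single zero    = refl
d-single (suc n) = d-one-row (suc n)

-- A single column

strictDec-single : ∀ ρ → length ρ ≤ 1 → strictDec ρ ≡ true
strictDec-single []          _        = refl
strictDec-single (_ ∷ [])    _        = refl
strictDec-single (_ ∷ _ ∷ _) (s≤s ())

cell-beyond-single-column : ∀ T i c → All (λ ρ → length ρ ≤ 1) T → cell T i (suc c) ≡ nothing
cell-beyond-single-column T i c short with at T i in e
... | nothing = refl
... | just ρ  = at-beyond-length ρ (ℕₚ.≤-trans (All.lookup short (at-∈ T i e)) (s≤s z≤n))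

tripleAt-single-column : ∀ T i i′ c → All (λ ρ → length ρ ≤ 1) T → tripleAt T i i′ c ≡ true
tripleAt-single-column T i i′ c short rewrite cell-beyond-single-column T i′ c short = refl

triples-single-column : ∀ T → All (λ ρ → length ρ ≤ 1) T → ∀ is is′ cs →
  allB (λ i′ → allB (λ i → if i <ᵇ i′ then allB (tripleAt T i i′) cs else true) is) is′ ≡ true
triples-single-column T short is is′ cs =
  allB-All _ is′ (All.tabulate λ {i′} _ → allB-All (λ i → if i <ᵇ i′ then allB (tripleAt T i i′) cs else true) is
    (All.tabulate λ {i} _ → if-else-true (i <ᵇ i′)
      (allB-All (tripleAt T i i′) cs (All.tabulate λ {c} _ → tripleAt-single-column T i i′ c short))))

isSRCT-single-column : ∀ T → All (λ ρ → length ρ ≤ 1) T → isSRCT T ≡ strictInc (firstColumn T)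
isSRCT-single-column T short
  rewrite allB-All strictDec T (All.map (λ {ρ} → strictDec-single ρ) short)
        | triples-single-column T short (upTo (length T)) (upTo (length T)) (upTo (sum (map length T)))
  = ∧-identityʳ (strictInc (firstColumn T))

firstColumn-ones : ∀ N w → firstColumn (cut (replicate N 1) w) ≡ take N w
firstColumn-ones zero    w       = refl
firstColumn-ones (suc N) []      = trans (firstColumn-ones N []) (Listₚ.take-[] N)
firstColumn-ones (suc N) (x ∷ w) = cong (x ∷_) (firstColumn-ones N w)

column-single-column : ∀ T {m} → All (λ ρ → length ρ ≤ 1) T → m ∈ concat T → column T m ≡ just 0
column-single-column T short m∈ with column-present T m∈
... | c , e = trans e (cong just (ℕₚ.n<1⇒n≡0 (column-bounded T short e)))

-- In a single column every entry m + 1 lies weakly right of m.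
descentSet-single-column : ∀ T → All (λ ρ → length ρ ≤ 1) T →
  (∀ m → 1 ≤ m → m ≤ sum (map length T) → m ∈ concat T) →
  descentSet T ≡ range1 (sum (map length T) ℕ.∸ 1)
descentSet-single-column T short present =
  Listₚ.filter-all (λ m → isDescent T m Bool.≟ true) (All.tabulate λ {m} m∈ →
    let 1≤m , m≤ = ∈-range1⁻ m∈ in
    isDescent-columns T (column-single-column T short (present m 1≤m (ℕₚ.≤pred⇒≤ m≤)))
                        (column-single-column T short (present (suc m) (s≤s z≤n) (≤pred⇒< 1≤m m≤))))

d-ones : ∀ N → d (replicate N 1) (replicate N 1) ≡ 1
d-ones N =
  trans (d≡count ones ones strictInc agree)
        (count-permutations-of-sorted strictInc insertions-strictInc (range1 (sum ones)) (range1-sorted (sum ones)) refl)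
  where
  ones : List ℕ
  ones = replicate N 1
  single-column : ∀ w → All (λ ρ → length ρ ≤ 1) (cut ones w)
  single-column w = cut-rows-≤ ones w (Allₚ.replicate⁺ N ℕₚ.≤-refl)

  descentSet-cut-ones : ∀ {w} → w ↭ range1 (sum ones) → descentSet (cut ones w) ≡ partialSums ones
  descentSet-cut-ones {w} w↭ = begin
    descentSet (cut ones w)                               ≡⟨ descentSet-single-column (cut ones w) (single-column w) present ⟩
    range1 (sum (map length (cut ones w)) ℕ.∸ 1)          ≡⟨ cong (λ S → range1 (S ℕ.∸ 1)) (trans (size-cut ones w len) (sum-ones N)) ⟩
    range1 (N ℕ.∸ 1)                                      ≡⟨ sym (partialSums-ones N) ⟩
    partialSums ones                                      ∎
    where
    open ≡.≡-Reasoning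
    len : length w ≡ sum ones
    len = length-↭-range1 w↭
    present : ∀ m → 1 ≤ m → m ≤ sum (map length (cut ones w)) → m ∈ concat (cut ones w)
    present m 1≤m m≤ = subst (m ∈_) (sym (concat-cut ones w len))
      (∈-↭-range1⁺ w↭ 1≤m (subst (m ≤_) (size-cut ones w len) m≤))

  agree : ∀ {w} → w ↭ range1 (sum ones) → srctWithDescents ones ones (cut ones w) ≡ strictInc w
  agree {w} w↭
    rewrite isSRCT-single-column (cut ones w) (single-column w) | firstColumn-ones N w
          | Listₚ.take-all N w (ℕₚ.≤-reflexive (trans (length-↭-range1 w↭) (sum-ones N)))
          | ≡ᵇ-refl (sum ones) | descentSet-cut-ones w↭ | ==ᴸ-refl (partialSums ones)
    = ∧-identityʳ (strictInc w)

-- Vanishing coefficients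

-- Without descents the entries M, M-1, …, 1 move strictly rightwards, which needs a row of length M.
short-rows-force-a-descent : ∀ T M → 1 ≤ M → (∀ m → 1 ≤ m → m ≤ M → m ∈ concat T) →
  All (λ ρ → length ρ ≤ M ℕ.∸ 1) T → ¬ (∀ m → 1 ≤ m → m < M → isDescent T m ≡ false)
short-rows-force-a-descent T (suc k) _ present short ascents
  with column-present T (present (suc k) (s≤s z≤n) ℕₚ.≤-refl)
... | c , e with column-decreasing-along-non-descents T 1 k present ascents e
... | c′ , e′ , k+c≤c′ =
  ℕₚ.<-irrefl refl (ℕₚ.≤-<-trans (ℕₚ.≤-trans (ℕₚ.m≤m+n k c) k+c≤c′) (column-bounded T short e′))

d-vanishes-without-descents : ∀ {α} β → IsComposition α → 2 ≤ length α → partialSums β ≡ [] → d α β ≡ 0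
d-vanishes-without-descents {[]}            β _                 ()
d-vanishes-without-descents {α@(a ∷ rest)} β α⁺@(0<a ∷ _) long no-partial-sums = d≡0 α β not-counted
  where
  parts<M : All (_< sum α) α
  parts<M = parts-<-sum α⁺ long
  1≤M : 1 ≤ sum α
  1≤M = ℕₚ.≤-trans 0<a (ℕₚ.m≤m+n a (sum rest))

  not-counted : ∀ {w} → w ↭ range1 (sum α) → srctWithDescents α β (cut α w) ≢ true
  not-counted {w} w↭ counted =
    short-rows-force-a-descent T (sum α) 1≤M present (cut-rows-≤ α w (All.map ℕₚ.<⇒≤pred parts<M)) ascents
    where
    T : Filling
    T = cut α w
    len : length w ≡ sum α
    len = length-↭-range1 w↭
    present : ∀ m → 1 ≤ m → m ≤ sum α → m ∈ concat T
    present m 1≤m m≤M = subst (m ∈_) (sym (concat-cut α w len)) (∈-↭-range1⁺ w↭ 1≤m m≤M)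
    ascents : ∀ m → 1 ≤ m → m < sum α → isDescent T m ≡ false
    ascents m 1≤m m<M = ¬-not λ desc →
      case subst (m ∈_) (trans (proj₂ (proj₂ (srctWithDescents⁻ α β T counted))) no-partial-sums)
             (∈-descentSet T 1≤m (subst (λ S → m ≤ S ℕ.∸ 1) (sym (size-cut α w len)) (ℕₚ.<⇒≤pred m<M)) desc)
      of λ ()

-- x and y sit in columns 1 and 0, and descents never move left.
row-head-forces-non-descent : ∀ T {y x ρ} → (y ∷ x ∷ ρ) ∈ T → Unique (concat T) → x < y →
  ¬ (∀ m → x ≤ m → m < y → isDescent T m ≡ true)
row-head-forces-non-descent T {y} {x} {ρ} row∈ unique x<y descents =
  let c , e , 1≤c = run
  in ℕₚ.1+n≰n (subst (1 ≤_) (just-injective (trans (sym (subst (λ n → column T n ≡ just c) x+[y∸x]≡y e))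
                                                  column-y))
                         1≤c)
  where
  x+[y∸x]≡y : x ℕ.+ (y ℕ.∸ x) ≡ y
  x+[y∸x]≡y = ℕₚ.m+[n∸m]≡n (ℕₚ.<⇒≤ x<y)
  column-y : column T y ≡ just 0
  column-y = column-of-row T row∈ unique (columnIn-head y (x ∷ ρ))
  run : ∃ λ c → column T (x ℕ.+ (y ℕ.∸ x)) ≡ just c × 1 ≤ c
  run = column-weakly-increasing-along-descents T x (y ℕ.∸ x)
          (λ m x≤m m< → descents m x≤m (subst (m <_) x+[y∸x]≡y m<))
          (column-of-row T row∈ unique (columnIn-second ρ (ℕₚ.>⇒≢ x<y)))

d-vanishes-at-ones : ∀ {α} N → Any (2 ≤_) α → d α (replicate N 1) ≡ 0
d-vanishes-at-ones {α} N big = d≡0 α (replicate N 1) not-counted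
  where
  not-counted : ∀ {w} → w ↭ range1 (sum α) → srctWithDescents α (replicate N 1) (cut α w) ≢ true
  not-counted {w} w↭ counted with find (cut-long-row α w big (length-↭-range1 w↭))
  ... | []          , _    , ()
  ... | _ ∷ []      , _    , s≤s ()
  ... | y ∷ x ∷ ρ , row∈ , _ = row-head-forces-non-descent T row∈ unique x<y descents
    where
    T : Filling
    T = cut α w
    srct&size&descents : isSRCT T ≡ true × sum α ≡ sum (replicate N 1) × descentSet T ≡ partialSums (replicate N 1)
    srct&size&descents = srctWithDescents⁻ α (replicate N 1) T counted
    concat-T : concat T ≡ w
    concat-T = concat-cut α w (length-↭-range1 w↭)
    unique : Unique (concat T)
    unique = subst Unique (sym concat-T) (unique-↭-range1 {M = sum α} w↭)
    entry-bounds : ∀ {z} → z ∈ (y ∷ x ∷ ρ) → 1 ≤ z × z ≤ sum α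
    entry-bounds z∈ = ∈-↭-range1⁻ w↭ (subst (_ ∈_) concat-T (∈-concat⁺′ z∈ row∈))
    x<y : x < y
    x<y = <ᵇ≡true⇒< (∧-conicalˡ (x <ᵇ y) _
            (allB-∈ strictDec (∧-conicalˡ (allB strictDec T) _ (proj₁ srct&size&descents)) row∈))
    M≡N : sum α ≡ N
    M≡N = trans (proj₁ (proj₂ srct&size&descents)) (sum-ones N)
    descents : ∀ m → x ≤ m → m < y → isDescent T m ≡ true
    descents m x≤m m<y = descentSet-descent T (subst (m ∈_)
      (sym (trans (proj₂ (proj₂ srct&size&descents)) (partialSums-ones N)))
      (∈-range1⁺ (ℕₚ.≤-trans (proj₁ (entry-bounds (there (here refl)))) x≤m)
                 (ℕₚ.<⇒≤pred (ℕₚ.<-≤-trans m<y (subst (y ≤_) M≡N (proj₂ (entry-bounds (here refl))))))))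

lemma3p7 : (s : List ℕ → NSym) → IsNCSchur s → (n : ℕ) →
    (s (single n) ≈ r (single n)) × (s (replicate n 1) ≈ r (replicate n 1))
lemma3p7 s schur n =
  let L₁ , split₁ , long = compositions-single n
      L₂ , split₂ , big  = compositions-ones n
  in s≈r-if-d-concentrated schur L₁ [] (single-composition n) split₁ (d-single n)
       (All.map (λ (α⁺ , 2≤l) → d-vanishes-without-descents (single n) α⁺ 2≤l (partialSums-single n)) long) [] ,
     s≈r-if-d-concentrated schur [] L₂ (Allₚ.replicate⁺ n (s≤s z≤n)) split₂ (d-ones n)
       [] (All.map (d-vanishes-at-ones n) big)
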